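{- Let $T$ be a (straight) Kashiwara–Nakashima tableau of rectangular shape on the alphabet $[\pm n]$ with columns $C_1,\dots,C_k$ from left to right. Then its right key tableau is $K_+(T)=rC_k\, rC_k \cdots rC_k$ ($k$ copies of the column $rC_k$).
   Context: Fix $n\ge1$. The alphabet is $[\pm n]=\{1,\dots,n,\overline{n},\dots,\overline{1}\}$, totally ordered by $1<\dots<n<\overline{n}<\dots<\overline{1}$, with $\overline{\overline{i}}=i$. A column is a strictly increasing sequence in $[\pm n]$. For a column $C$, let $I=\{z_1>\dots>z_r\}$ be the unbarred $z$ with $z,\overline z\in C$. $C$ is admissible iff there are $t_1>\dots>t_r$ in $[n]$ with $t_1$ the greatest letter $<z_1$ with $t_1,\overline{t_1}\notin C$, and $t_i$ the greatest letter $<\min(t_{i-1},z_i)$ with $t_i,\overline{t_i}\notin C$. Then $rC$ is obtained from $C$ by replacing each $\overline{z_i}$ by $\overline{t_i}$ and reordering, and $\ell C$ by replacing each $z_i$ by $t_i$ and reordering. $\Phi(C)$ has the unbarred entries of $\ell C$ and the barred entries of $rC$; it is invertible. A KN tableau is a filling with admissible columns whose split form (each column $C$ replaced by $\ell C\, rC$) is semistandard. Sheats' symplectic jeu de taquin (SJDT) on a punctured KN skew tableau, with puncture in column $C_1$ and right neighbour $C_2$, with $\alpha$ the entry of $rC_1$ below the puncture and $\beta$ the entry of $\ell C_2$ to its right: if $\beta$ does not exist or $\alpha\le\beta$, the puncture moves down; otherwise, if $\beta$ is barred, $C_2'=C_2$ with $\beta$ replaced by $\ast$ and $C_1'=\Phi^{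 -1}(\Phi(C_1)$ with $\ast$ replaced by $\beta)$; if $\beta$ unbarred, $C_1'=C_1$ with $\ast$ replaced by $\beta$ and $C_2'=\Phi^{ -1}(\Phi(C_2)$ with $\beta$ replaced by $\ast)$ (erasing $i,\overline i$ and a cell if $C_1'$ breaks the one-column condition at $i$); repeated until no $\alpha,\beta$, then the puncture cell is deleted. Rectification applies this from inner corners until a straight shape is reached. For a straight KN tableau $T$, for each rearrangement of its column lengths there is a unique KN skew tableau with those column lengths rectifying to $T$, whose last column depends only on its length; the right key $K_+(T)$ replaces each column of $T$ of length $h$ by $rD$, where $D$ is the last column of length $h$ of such a skew tableau. -}

module Defs where

open import Data.Nat using (ℕ; zero; suc; _+_; _*_; _∸_; _≤_; _<_; _≤ᵇ_; _≡ᵇ_; _⊓_)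
open import Data.Bool using (Bool; true; false; if_then_else_; _∧_; not; T)
open import Data.List using (List; []; _∷_; _++_; map; foldr; reverse; zip; length; take; drop; _∷ʳ_; concatMap)
open import Data.Maybe using (Maybe; just; nothing; is-just)
open import Data.Product using (_×_; _,_; proj₁; proj₂; ∃)
open import Data.Sum using (_⊎_)
open import Relation.Nullary using (¬_)
open import Relation.Binary.PropositionalEquality using (_≡_)
open import Data.List.Relation.Unary.All using (All)
open import Data.List.Relation.Unary.Linked using (Linked)
open import Data.List.Relation.Binary.Pointwise using (Pointwise)
open import Data.List.Relation.Binary.Permutation.Propositional using (_↭_)

-- We encode the letters by natural numbers so that the
-- order 1 < ... < n < n̄ < ... < 1̄ is the order of ℕ:
--   unbarred i  ↦ i          (1 ≤ i ≤ n)
--   barred  ī   ↦ 2n+1-i     (so n̄ ↦ n+1, ..., 1̄ ↦ 2n)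
-- A letter is thus a natural number x with 1 ≤ x ≤ 2n.

Letter : ℕ → ℕ → Set
Letter n x = 1 ≤ x × x ≤ 2 * n

bar : ℕ → ℕ → ℕ
bar n x = suc (2 * n) ∸ x

unbarred : ℕ → ℕ → Bool
unbarred n x = x ≤ᵇ n

Unbarred Barred : ℕ → ℕ → Set
Unbarred n x = T (unbarred n x)
Barred n x = T (not (unbarred n x))

-- A column: list of letters read from top to bottom.
Col : Set
Col = List ℕ

IsColumn : ℕ → Col → Set
IsColumn n C = All (Letter n) C × Linked _<_ C

mem : ℕ → List ℕ → Bool
mem x [] = false
mem x (y ∷ ys) = if y ≡ᵇ x then true else mem x ys

filterB : (ℕ → Bool) → List ℕ → List ℕ
filterB p [] = []
filterB p (x ∷ xs) = if p x then x ∷ filterB p xs else filterB p xs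

insertS : ℕ → List ℕ → List ℕ
insertS x [] = x ∷ []
insertS x (y ∷ ys) = if x ≤ᵇ y then x ∷ y ∷ ys else y ∷ insertS x ys

sortS : List ℕ → List ℕ
sortS = foldr insertS []

at : List ℕ → ℕ → Maybe ℕ
at [] i = nothing
at (x ∷ xs) zero = just x
at (x ∷ xs) (suc i) = at xs i

insertAt : ℕ → ℕ → List ℕ → List ℕ
insertAt k x xs = take k xs ++ x ∷ drop k xs

lookupZ : List (ℕ × ℕ) → ℕ → Maybe ℕ
lookupZ [] z = nothing
lookupZ ((a , b) ∷ ps) z = if a ≡ᵇ z then just b else lookupZ ps z

-- I(C) = {z unbarred : z, z̄ ∈ C}, listed decreasingly z₁ > ... > z_r
Iset : ℕ → Col → List ℕ
Iset n C = reverse (filterB (λ z → unbarred n z ∧ mem (bar n z) C) C)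

free : ℕ → Col → ℕ → Bool
free n C t = not (mem t C) ∧ not (mem (bar n t) C)

greatestBelow : ℕ → Col → ℕ → Maybe ℕ
greatestBelow n C (suc (suc t)) =
  if free n C (suc t) then just (suc t) else greatestBelow n C (suc t)
greatestBelow n C _ = nothing

-- t_i = greatest free letter < min(bound, z_i), bound = t_{i-1}
-- (for i = 1 the bound n is harmless since z₁ ≤ n)
tList : ℕ → Col → ℕ → List ℕ → Maybe (List ℕ)
tList n C b [] = just []
tList n C b (z ∷ zs) with greatestBelow n C (b ⊓ z)
... | nothing = nothing
... | just t with tList n C t zs
...   | nothing = nothing
...   | just ts = just (t ∷ ts)

tvals : ℕ → Col → Maybe (List ℕ)
tvals n C = tList n C n (Iset n C)

Admissible : ℕ → Col → Set
Admissible n C = IsColumn n C × T (is-just (tvals n C))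

zt : ℕ → Col → List (ℕ × ℕ)
zt n C with tvals n C
... | just ts = zip (Iset n C) ts
... | nothing = []

rCol : ℕ → Col → Col
rCol n C = sortS (map f C)
  where
  f : ℕ → ℕ
  f x with unbarred n x | lookupZ (zt n C) (bar n x)
  ... | true  | _ = x
  ... | false | just t = bar n t
  ... | false | nothing = x

lCol : ℕ → Col → Col
lCol n C = sortS (map g C)
  where
  g : ℕ → ℕ
  g x with unbarred n x | lookupZ (zt n C) x
  ... | true  | just t = t
  ... | true  | nothing = x
  ... | false | _ = x

Φ : ℕ → Col → Col
Φ n C = sortS (filterB (unbarred n) (lCol n C) ++ filterB (λ x → not (unbarred n x)) (rCol n C))

-- A skew tableau is a list of columns (left to right),
-- each given as (a , C): C occupies rows a+1, ..., a+|C| (rows numbered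
-- from the top, English convention), i.e. a = μ'_j and a + |C| = λ'_j.

SkewTab : Set
SkewTab = List (ℕ × Col)

SkewShape : SkewTab → Set
SkewShape S = Linked (λ p q → proj₁ q ≤ proj₁ p × proj₁ q + length (proj₂ q) ≤ proj₁ p + length (proj₂ p)) S

split : ℕ → SkewTab → SkewTab
split n = concatMap (λ p → (proj₁ p , lCol n (proj₂ p)) ∷ (proj₁ p , rCol n (proj₂ p)) ∷ [])

RowWeak : (ℕ × Col) → (ℕ × Col) → Set
RowWeak (a , X) (b , Y) =
  ∀ i j x y → a + i ≡ b + j → at X i ≡ just x → at Y j ≡ just y → x ≤ y

SemistandardSplit : ℕ → SkewTab → Set
SemistandardSplit n S = All (λ p → Linked _<_ (proj₂ p)) (split n S) × Linked RowWeak (split n S)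

KNSkew : ℕ → SkewTab → Set
KNSkew n S = SkewShape S × All (λ p → Admissible n (proj₂ p)) S × SemistandardSplit n S

KNStraight : ℕ → List Col → Set
KNStraight n Tb = All (λ C → ¬ (C ≡ [])) Tb × KNSkew n (map (λ C → (0 , C)) Tb)

-- A punctured skew tableau: left columns L, the punctured column
-- (o , A , B) (entries A above the puncture ∗, entries B below; the
-- column occupies rows o+1 ... o+|A|+1+|B|, ∗ in row o+|A|+1), and the
-- right columns R.  The split form of the punctured column is the split
-- form of A ++ B with ∗ kept at the same height; likewise for Φ.

record Punctured : Set where
  constructor punct
  field
    left  : SkewTab
    off   : ℕ
    above : Col
    below : Col
    right : SkewTab

-- α: entry of rC₁ below the puncture
alphaOf : ℕ → Col → Col → Maybe ℕ
alphaOf n A B = at (rCol n (A ++ B)) (length A)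

-- β: entry of ℓC₂ to the right of the puncture (puncture at 0-indexed row p)
betaOf : ℕ → ℕ → SkewTab → Maybe ℕ
betaOf n p [] = nothing
betaOf n p ((b , D) ∷ _) = if b ≤ᵇ p then at (lCol n D) (p ∸ b) else nothing

-- "β does not exist or α ≤ β"  (with α existing: puncture moves down)
-- "otherwise" : β exists and (α does not exist or β < α)
MoveRight : Maybe ℕ → ℕ → Set
MoveRight α β = (α ≡ nothing) ⊎ ∃ (λ a → α ≡ just a × β < a)

-- Slide n P S' : the slide of the punctured tableau P ends with S'.
-- (Φ⁻¹(X) is rendered as "an admissible column E with Φ E ≡ X"; Φ is
-- injective on admissible columns.)
data Slide (n : ℕ) : Punctured → SkewTab → Set where
  finish : ∀ {L o A R} →
    betaOf n (o + length A) R ≡ nothing →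
    Slide n (punct L o A [] R) (L ++ (o , A) ∷ R)
  down : ∀ {L o A x B R S'} →
    (betaOf n (o + length A) R ≡ nothing ⊎
      ∃ (λ α → ∃ (λ β → alphaOf n A (x ∷ B) ≡ just α × betaOf n (o + length A) R ≡ just β × α ≤ β))) →
    Slide n (punct L o (A ∷ʳ x) B R) S' →
    Slide n (punct L o A (x ∷ B) R) S'
  rightBarred : ∀ {L o A B b D R β D₁ D₂ E S'} →
    betaOf n (o + length A) ((b , D) ∷ R) ≡ just β →
    Barred n β →
    MoveRight (alphaOf n A B) β →
    D ≡ D₁ ++ β ∷ D₂ →
    Admissible n E →
    Φ n E ≡ insertAt (length A) β (Φ n (A ++ B)) →
    Slide n (punct (L ∷ʳ (o , E)) b D₁ D₂ R) S' →
    Slide n (punct L o A B ((b , D) ∷ R)) S'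
  -- β unbarred (case where C₁' satisfies the one-column condition)
  rightUnbarred : ∀ {L o A B b D R β P₁ P₂ E S'} →
    betaOf n (o + length A) ((b , D) ∷ R) ≡ just β →
    Unbarred n β →
    MoveRight (alphaOf n A B) β →
    Admissible n (A ++ β ∷ B) →
    Φ n D ≡ P₁ ++ β ∷ P₂ →
    Admissible n E →
    Φ n E ≡ P₁ ++ P₂ →
    Slide n (punct (L ∷ʳ (o , A ++ β ∷ B)) b (take (length P₁) E) (drop (length P₁) E) R) S' →
    Slide n (punct L o A B ((b , D) ∷ R)) S'

InnerCornerRight : ℕ → SkewTab → Set
InnerCornerRight a [] = Data.Unit.⊤
  where import Data.Unit
InnerCornerRight a ((b , _) ∷ _) = b ≤ a

nonemptyCols : SkewTab → List Col
nonemptyCols [] = []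
nonemptyCols ((a , []) ∷ S) = nonemptyCols S
nonemptyCols ((a , x ∷ C) ∷ S) = (x ∷ C) ∷ nonemptyCols S

data RectifiesTo (n : ℕ) : SkewTab → List Col → Set where
  done : ∀ {S Tb} → All (λ p → proj₁ p ≡ 0) S → nonemptyCols S ≡ Tb → RectifiesTo n S Tb
  slide : ∀ {L a C R S' Tb} →
    InnerCornerRight a R →
    Slide n (punct L a [] C R) S' →
    RectifiesTo n S' Tb →
    RectifiesTo n (L ++ (suc a , C) ∷ R) Tb

IsRightKey : ℕ → List Col → List Col → Set
IsRightKey n Tb K =
  Pointwise (λ C KC → ∀ (Ss : SkewTab) (a : ℕ) (D : Col) →
                KNSkew n (Ss ∷ʳ (a , D)) →
                map (λ p → length (proj₂ p)) (Ss ∷ʳ (a , D)) ↭ map length Tb →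
                length D ≡ length C →
                RectifiesTo n (Ss ∷ʳ (a , D)) Tb →
                KC ≡ rCol n D) Tb K

-- A slide of symplectic jeu de taquin keeps the number of columns, and the
-- column to the right of the puncture only changes by losing an entry (Φ
-- preserves length).  So the last column of a skew tableau is either left
-- untouched by a slide or replaced by a strictly shorter column.  If the skew
-- tableau has the column lengths of the rectangle T and its last column D has
-- the common height of T, then D survives rectification, hence D = C_k, and
-- every column of K₊(T) is rC_k.
module Submission where

open import Defs
open import Data.Nat using (ℕ; zero; suc; _+_; _≤_; _<_; _⊓_; _≡ᵇ_; _≤ᵇ_; _≤?_; s≤s; z≤n)
open import Data.Nat.Properties
open import Data.Bool using (true; false; not; if_then_else_)
open import Data.Maybe using (Maybe; just; nothing)
import Data.Maybe.Relation.Binary.Pointwise as Maybe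
open import Data.List using (List; []; _∷_; _++_; _∷ʳ_; length; replicate; map; zip; filter; last)
open import Data.List.Properties using (length-++; length-map; ++-assoc; ++-identityʳ; map-++; take++drop≡id)
open import Data.List.Membership.Propositional using (_∈_)
open import Data.List.Relation.Unary.Any using (here; there)
open import Data.List.Relation.Unary.All using (All; []; _∷_)
import Data.List.Relation.Unary.All as All
open import Data.List.Relation.Binary.Pointwise using (Pointwise; []; _∷_)
open import Data.List.Relation.Binary.Permutation.Propositional using (_↭_; ↭-refl; ↭-prep; ↭-swap; ↭-trans)
open import Data.List.Relation.Binary.Permutation.Propositional.Properties using (↭-length; filter-↭)
open import Data.Product using (∃; _,_; proj₁; proj₂)
open import Data.Sum using (_⊎_; inj₁; inj₂)
open import Function using (_∘_)
open import Relation.Binary.PropositionalEquality using (_≡_; refl; sym; trans; cong; cong₂; subst; subst₂; _≗_; module ≡-Reasoning)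
open import Relation.Nullary using (contradiction)
open import Relation.Nullary.Decidable using (T?; dec-true; dec-false)

greatestBelow-≤ : ∀ n C m {t} → greatestBelow n C (suc m) ≡ just t → t ≤ m
greatestBelow-≤ n C zero ()
greatestBelow-≤ n C (suc m) {t} = next (free n C (suc m))
  where
  next : ∀ b → (if b then just (suc m) else greatestBelow n C (suc m)) ≡ just t → t ≤ suc m
  next true  refl = ≤-refl
  next false h    = m≤n⇒m≤1+n (greatestBelow-≤ n C m h)

greatestBelow-< : ∀ n C m {t} → greatestBelow n C m ≡ just t → t < m
greatestBelow-< n C zero ()
greatestBelow-< n C (suc m) h = s≤s (greatestBelow-≤ n C m h)

tList-< : ∀ n C b zs {ts} → tList n C b zs ≡ just ts → All (_< b) ts
tList-< n C b [] refl = []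
tList-< n C b (z ∷ zs) h with greatestBelow n C (b ⊓ z) in eq | h
... | just t | h′ with tList n C t zs in eq′ | h′
...   | just ts | refl = t<b ∷ All.map (λ s<t → <-trans s<t t<b) (tList-< n C t zs eq′)
  where
  t<b : t < b
  t<b = <-≤-trans (greatestBelow-< n C (b ⊓ z) eq) (m⊓n≤m b z)

lookupZ-zip-∈ : ∀ zs ts {y t} → lookupZ (zip zs ts) y ≡ just t → t ∈ ts
lookupZ-zip-∈ (z ∷ zs) (s ∷ ts) {y} h with z ≡ᵇ y | h
... | true  | refl = here refl
... | false | h′   = there (lookupZ-zip-∈ zs ts h′)

zt-< : ∀ n C {y t} → lookupZ (zt n C) y ≡ just t → t < n
zt-< n C h with tvals n C in eq | h
... | just ts | h′ = All.lookup (tList-< n C n (Iset n C) eq) (lookupZ-zip-∈ (Iset n C) ts h′)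

≤⇒unbarred : ∀ {n t} → t ≤ n → unbarred n t ≡ true
≤⇒unbarred {n} {t} = dec-true (t ≤? n)

n<bar : ∀ {n t} → t ≤ n → n < bar n t
n<bar {n} t≤n = m+n≤o⇒m≤o∸n (suc n) (s≤s (+-monoʳ-≤ n (≤-trans t≤n (m≤m+n n 0))))

barred-bar : ∀ {n t} → t ≤ n → unbarred n (bar n t) ≡ false
barred-bar {n} {t} t≤n = dec-false (bar n t ≤? n) (<⇒≱ (n<bar t≤n))

-- The letterwise maps underlying rC and ℓC are local to Defs; unifying
-- against refl gives them names.
rCol-as-map : ∀ n C → ∃ λ (h : ℕ → ℕ) → rCol n C ≡ sortS (map h C)
rCol-as-map n C = _ , refl

lCol-as-map : ∀ n C → ∃ λ (h : ℕ → ℕ) → lCol n C ≡ sortS (map h C)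
lCol-as-map n C = _ , refl

rLetter lLetter : ℕ → Col → ℕ → ℕ
rLetter n C = proj₁ (rCol-as-map n C)
lLetter n C = proj₁ (lCol-as-map n C)

unbarred-rLetter : ∀ n C x → unbarred n (rLetter n C x) ≡ unbarred n x
unbarred-rLetter n C x with unbarred n x in e | lookupZ (zt n C) (bar n x) in eq
... | true  | _       = e
... | false | just t  = barred-bar (<⇒≤ (zt-< n C eq))
... | false | nothing = e

unbarred-lLetter : ∀ n C x → unbarred n (lLetter n C x) ≡ unbarred n x
unbarred-lLetter n C x with unbarred n x in e | lookupZ (zt n C) x in eq
... | true  | just t  = ≤⇒unbarred (<⇒≤ (zt-< n C eq))
... | true  | nothing = e
... | false | _       = e

insertS-↭ : ∀ x xs → insertS x xs ↭ x ∷ xs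
insertS-↭ x [] = ↭-refl
insertS-↭ x (y ∷ ys) with x ≤ᵇ y
... | true  = ↭-refl
... | false = ↭-trans (↭-prep y (insertS-↭ x ys)) (↭-swap y x ↭-refl)

sortS-↭ : ∀ xs → sortS xs ↭ xs
sortS-↭ [] = ↭-refl
sortS-↭ (x ∷ xs) = ↭-trans (insertS-↭ x (sortS xs)) (↭-prep x (sortS-↭ xs))

filterB≗filter : ∀ p → filterB p ≗ filter (T? ∘ p)
filterB≗filter p [] = refl
filterB≗filter p (x ∷ xs) with p x
... | true  = cong (x ∷_) (filterB≗filter p xs)
... | false = filterB≗filter p xs

length-filterB-↭ : ∀ p {xs ys} → xs ↭ ys → length (filterB p xs) ≡ length (filterB p ys)
length-filterB-↭ p {xs} {ys} xs↭ys =
  subst₂ (λ u v → length u ≡ length v) (sym (filterB≗filter p xs)) (sym (filterB≗filter p ys))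
    (↭-length (filter-↭ (T? ∘ p) xs↭ys))

filterB-map : ∀ p h → (∀ x → p (h x) ≡ p x) → ∀ xs → filterB p (map h xs) ≡ map h (filterB p xs)
filterB-map p h ph [] = refl
filterB-map p h ph (x ∷ xs) rewrite ph x with p x
... | true  = cong (h x ∷_) (filterB-map p h ph xs)
... | false = filterB-map p h ph xs

length-filterB-sortS-map : ∀ p h → (∀ x → p (h x) ≡ p x) → ∀ xs →
  length (filterB p (sortS (map h xs))) ≡ length (filterB p xs)
length-filterB-sortS-map p h ph xs = begin
  length (filterB p (sortS (map h xs))) ≡⟨ length-filterB-↭ p (sortS-↭ (map h xs)) ⟩
  length (filterB p (map h xs))         ≡⟨ cong length (filterB-map p h ph xs) ⟩
  length (map h (filterB p xs))         ≡⟨ length-map h (filterB p xs) ⟩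
  length (filterB p xs)                 ∎
  where open ≡-Reasoning

length-filterB-not : ∀ p xs → length (filterB p xs) + length (filterB (not ∘ p) xs) ≡ length xs
length-filterB-not p [] = refl
length-filterB-not p (x ∷ xs) with p x
... | true  = cong suc (length-filterB-not p xs)
... | false = trans (+-suc _ _) (cong suc (length-filterB-not p xs))

length-Φ : ∀ n X → length (Φ n X) ≡ length X
length-Φ n X = begin
  length (Φ n X)
    ≡⟨ ↭-length (sortS-↭ (filterB u (lCol n X) ++ filterB (not ∘ u) (rCol n X))) ⟩
  length (filterB u (lCol n X) ++ filterB (not ∘ u) (rCol n X))
    ≡⟨ length-++ (filterB u (lCol n X)) ⟩
  length (filterB u (lCol n X)) + length (filterB (not ∘ u) (rCol n X))
    ≡⟨ cong₂ _+_ (length-filterB-sortS-map u (lLetter n X) (unbarred-lLetter n X) X)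
                 (length-filterB-sortS-map (not ∘ u) (rLetter n X) (cong not ∘ unbarred-rLetter n X) X) ⟩
  length (filterB u X) + length (filterB (not ∘ u) X)
    ≡⟨ length-filterB-not u X ⟩
  length X ∎
  where
  open ≡-Reasoning
  u = unbarred n

_≼_ : Col → Col → Set
X ≼ Y = X ≡ Y ⊎ length X < length Y

≼-trans : ∀ {X Y Z} → X ≼ Y → Y ≼ Z → X ≼ Z
≼-trans (inj₁ refl) Y≼Z         = Y≼Z
≼-trans (inj₂ X<Y)  (inj₁ refl) = inj₂ X<Y
≼-trans (inj₂ X<Y)  (inj₂ Y<Z)  = inj₂ (<-trans X<Y Y<Z)

≼∧length≡⇒≡ : ∀ {X Y} → X ≼ Y → length X ≡ length Y → X ≡ Y
≼∧length≡⇒≡ (inj₁ X≡Y) _ = X≡Y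
≼∧length≡⇒≡ (inj₂ X<Y) X=Y = contradiction X=Y (<⇒≢ X<Y)

lastCol : SkewTab → Maybe Col
lastCol S = last (map proj₂ S)

_≼ₘ_ : Maybe Col → Maybe Col → Set
_≼ₘ_ = Maybe.Pointwise _≼_

last-++-∷ : ∀ {A : Set} (xs : List A) y ys → last (xs ++ y ∷ ys) ≡ last (y ∷ ys)
last-++-∷ []           y ys = refl
last-++-∷ (x ∷ [])     y ys = refl
last-++-∷ (x ∷ x′ ∷ xs) y ys = last-++-∷ (x′ ∷ xs) y ys

lastCol-++-∷ : ∀ L p R → lastCol (L ++ p ∷ R) ≡ lastCol (p ∷ R)
lastCol-++-∷ L p R = trans (cong last (map-++ proj₂ L (p ∷ R))) (last-++-∷ (map proj₂ L) (proj₂ p) (map proj₂ R))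

lastCol-shorter : ∀ a b R {X Y} → length X < length Y → lastCol ((a , X) ∷ R) ≼ₘ lastCol ((b , Y) ∷ R)
lastCol-shorter a b []      X<Y = Maybe.just (inj₂ X<Y)
lastCol-shorter a b (r ∷ R) X<Y = Maybe.refl (inj₁ refl)

length-++-shorter : ∀ (xs : Col) y zs → length (xs ++ zs) < length (xs ++ y ∷ zs)
length-++-shorter xs y zs =
  subst₂ _<_ (sym (length-++ xs)) (sym (length-++ xs)) (+-monoʳ-< (length xs) (n<1+n (length zs)))

length-∷ʳ-+ : ∀ (L : SkewTab) p k → length (L ∷ʳ p) + k ≡ length L + suc k
length-∷ʳ-+ L p k = trans (cong (_+ k) (length-++ L)) (+-assoc (length L) 1 k)

slide-length : ∀ {n L o A B R S′} → Slide n (punct L o A B R) S′ → length S′ ≡ length L + suc (length R)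
slide-length (finish {L = L} _) = length-++ L
slide-length (down _ d) = slide-length d
slide-length (rightBarred {L = L} {o = o} {R = R} {E = E} _ _ _ _ _ _ d) =
  trans (slide-length d) (length-∷ʳ-+ L (o , E) (suc (length R)))
slide-length (rightUnbarred {L = L} {o = o} {A = A} {B = B} {R = R} {β = β} _ _ _ _ _ _ _ d) =
  trans (slide-length d) (length-∷ʳ-+ L (o , A ++ β ∷ B) (suc (length R)))

slide-lastCol : ∀ {n L o A B R S′} → Slide n (punct L o A B R) S′ → lastCol S′ ≼ₘ lastCol ((o , A ++ B) ∷ R)
slide-lastCol (finish {L = L} {o} {A} {R} _)
  rewrite lastCol-++-∷ L (o , A) R | ++-identityʳ A = Maybe.refl (inj₁ refl)
slide-lastCol (down {o = o} {A = A} {x = x} {B = B} {R = R} _ d) =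
  subst (λ C → _ ≼ₘ lastCol ((o , C) ∷ R)) (++-assoc A (x ∷ []) B) (slide-lastCol d)
slide-lastCol (rightBarred {b = b} {R = R} {β = β} {D₁ = D₁} {D₂ = D₂} _ _ _ refl _ _ d) =
  Maybe.trans ≼-trans (slide-lastCol d) (lastCol-shorter b b R (length-++-shorter D₁ β D₂))
slide-lastCol {n} (rightUnbarred {b = b} {D = D} {R = R} {β = β} {P₁ = P₁} {P₂ = P₂} {E = E} _ _ _ _ ΦD _ ΦE d) =
  Maybe.trans ≼-trans
    (subst (λ C → _ ≼ₘ lastCol ((b , C) ∷ R)) (take++drop≡id (length P₁) E) (slide-lastCol d))
    (lastCol-shorter b b R E<D)
  where
  open ≤-Reasoning
  E<D : length E < length D
  E<D = begin-strict
    length E              ≡⟨ sym (length-Φ n E) ⟩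
    length (Φ n E)        ≡⟨ cong length ΦE ⟩
    length (P₁ ++ P₂)     <⟨ length-++-shorter P₁ β P₂ ⟩
    length (P₁ ++ β ∷ P₂) ≡⟨ cong length (sym ΦD) ⟩
    length (Φ n D)        ≡⟨ length-Φ n D ⟩
    length D              ∎

length-nonemptyCols-≤ : ∀ S → length (nonemptyCols S) ≤ length S
length-nonemptyCols-≤ [] = z≤n
length-nonemptyCols-≤ ((a , [])    ∷ S) = m≤n⇒m≤1+n (length-nonemptyCols-≤ S)
length-nonemptyCols-≤ ((a , x ∷ C) ∷ S) = s≤s (length-nonemptyCols-≤ S)

nonemptyCols-complete : ∀ S → length (nonemptyCols S) ≡ length S → nonemptyCols S ≡ map proj₂ S
nonemptyCols-complete [] _ = refl
nonemptyCols-complete ((a , [])    ∷ S) eq =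
  contradiction (length-nonemptyCols-≤ S) (<⇒≱ (≤-reflexive (sym eq)))
nonemptyCols-complete ((a , x ∷ C) ∷ S) eq = cong ((x ∷ C) ∷_) (nonemptyCols-complete S (suc-injective eq))

-- Equal column counts exclude columns emptied by a slide, which nonemptyCols
-- would silently drop.
rectify-lastCol : ∀ {n S Tb} → RectifiesTo n S Tb → length S ≡ length Tb → last Tb ≼ₘ lastCol S
rectify-lastCol {S = S} (done _ refl) eq
  rewrite nonemptyCols-complete S (sym eq) = Maybe.refl (inj₁ refl)
rectify-lastCol (slide {L = L} {a} {C} {R} {S′} _ sl r) eq =
  Maybe.trans ≼-trans (rectify-lastCol r (trans (slide-length sl) (trans (sym (length-++ L)) eq)))
    (subst (lastCol S′ ≼ₘ_) (sym (lastCol-++-∷ L (suc a , C) R)) (slide-lastCol sl))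

rectify-keeps-last : ∀ {n} Ss a D Cs Ck → RectifiesTo n (Ss ∷ʳ (a , D)) (Cs ∷ʳ Ck) →
  length (Ss ∷ʳ (a , D)) ≡ length (Cs ∷ʳ Ck) → length D ≡ length Ck → D ≡ Ck
rectify-keeps-last Ss a D Cs Ck r columns height = sym (≼∧length≡⇒≡ Ck≼D (sym height))
  where
  Ck≼D : Ck ≼ D
  Ck≼D = Maybe.drop-just (subst₂ _≼ₘ_ (last-++-∷ Cs Ck []) (lastCol-++-∷ Ss (a , D) [])
                                     (rectify-lastCol r columns))

All⇒Pointwise-replicate : ∀ {A B : Set} {P : A → Set} {R : A → B → Set} {y} →
  (∀ {x} → P x → R x y) → ∀ {xs} → All P xs → Pointwise R xs (replicate (length xs) y)
All⇒Pointwise-replicate P⇒R []       = []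
All⇒Pointwise-replicate P⇒R (p ∷ ps) = P⇒R p ∷ All⇒Pointwise-replicate P⇒R ps

mainTheorem2 : (n : ℕ) → 1 ≤ n → (Cs : List Col) (Ck : Col) →
    KNStraight n (Cs ∷ʳ Ck) →
    All (λ C → length C ≡ length Ck) (Cs ∷ʳ Ck) →
    IsRightKey n (Cs ∷ʳ Ck) (replicate (length (Cs ∷ʳ Ck)) (rCol n Ck))
mainTheorem2 n _ Cs Ck _ rectangular = All⇒Pointwise-replicate (λ {C} → keyColumn {C}) rectangular
  where
  keyColumn : ∀ {C} → length C ≡ length Ck → ∀ Ss a D →
    KNSkew n (Ss ∷ʳ (a , D)) →
    map (λ p → length (proj₂ p)) (Ss ∷ʳ (a , D)) ↭ map length (Cs ∷ʳ Ck) →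
    length D ≡ length C → RectifiesTo n (Ss ∷ʳ (a , D)) (Cs ∷ʳ Ck) → rCol n Ck ≡ rCol n D
  keyColumn hC Ss a D _ heights hD r =
    cong (rCol n) (sym (rectify-keeps-last Ss a D Cs Ck r columns (trans hD hC)))
    where
    columns : length (Ss ∷ʳ (a , D)) ≡ length (Cs ∷ʳ Ck)
    columns = trans (sym (length-map (λ p → length (proj₂ p)) (Ss ∷ʳ (a , D))))
                    (trans (↭-length heights) (length-map length (Cs ∷ʳ Ck)))
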